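{- Let $q\ge2$ and $n\ge1$ be integers. Under scenario $(\circ *)$, the family $\mathcal{N}_q=\{x\mapsto[\![x\ne t]\!]\}_{t\in[q\rangle}$ is $n$-cell implementable if and only if $q\le 2$ when $n=1$, and $q\le n$ when $n\ge 2$.
   Context: $[b\rangle=\{0,1,\ldots,b-1\}$. Let $\mathbb{B}=\{0,1\}$, $\mathbb{B}_\circ=\mathbb{B}$, $\mathbb{B}_*=\mathbb{B}\cup\{*\}$, $\mathbb{B}_\bullet=\mathbb{B}\cup\{*,\bullet\}$. Define $\mathrm{T}:\mathbb{B}_\bullet^2\to\mathbb{B}$ by $\mathrm{T}(u,\vartheta)=1$ if and only if $u=*$, or $\vartheta=*$, or $u=\vartheta\in\mathbb{B}$. $[\![\cdot]\!]$ is the Iverson bracket. $\mathcal{F}_q$ is the set of all functions $[q\rangle\to\mathbb{B}$. For $\alpha,\beta\in\{\circ,*,\bullet\}$, a subset $\Phi\subseteq\mathcal{F}_q$ is $n$-cell implementable under scenario $(\alpha\beta)$ if there exist mappings $\mathbf{u}=(u_j)_{j\in[n\rangle}:[q\rangle\to\mathbb{B}_\alpha^n$ and $\boldsymbol{\vartheta}=(\vartheta_j)_{j\in[n\rangle}:\Phi\to\mathbb{B}_\beta^n$ such that $f(x)=\bigwedge_{j\in[n\rangle}\mathrm{T}(u_j(x),\vartheta_j(f))$ for all $f\in\Phi$ and $x\in[q\rangle$. -}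

module Defs where

open import Data.Bool using (Bool; true; false; _∧_)
open import Data.Bool.Properties using ()
open import Data.Nat using (ℕ; zero; suc)
open import Data.Fin using (Fin; _≟_)
open import Relation.Nullary.Decidable using (⌊_⌋; ¬?)
open import Relation.Binary.PropositionalEquality using (_≡_)
open import Data.Product using (Σ)

data B• : Set where
  bit    : Bool → B•
  star   : B•
  bullet : B•

data B* : Set where
  bit  : Bool → B*
  star : B*

fromB∘ : Bool → B•
fromB∘ b = bit b

fromB* : B* → B•
fromB* (bit b) = bit b
fromB* star    = star

T : B• → B• → Bool
T star _ = true
T _ star = true
T (bit true)  (bit true)  = true
T (bit false) (bit false) = true
T _ _ = false

⋀ : (n : ℕ) → (Fin n → Bool) → Bool
⋀ zero    g = true
⋀ (suc n) g = g Fin.zero ∧ ⋀ n (λ j → g (Fin.suc j))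

-- A family Φ ⊆ 𝓕_q, given as an indexed family I → ([q⟩ → 𝔹), is
-- n-cell implementable under scenario (∘*)
Implementable∘* : (q n : ℕ) {I : Set} → (I → (Fin q → Bool)) → Set
Implementable∘* q n {I} Φ =
  Σ (Fin q → Fin n → Bool) λ u →
  Σ (I → Fin n → B*) λ ϑ →
  ∀ (f : I) (x : Fin q) →
    Φ f x ≡ ⋀ n (λ j → T (fromB∘ (u x j)) (fromB* (ϑ f j)))

𝒩 : (q : ℕ) → Fin q → (Fin q → Bool)
𝒩 q t x = ⌊ ¬? (x ≟ t) ⌋

-- If T(u x j, ϑ_t j) = 0 at x = t, then ϑ_t j = ¬ u t j, and since every x ≠ t passes cell j,
-- t is the only point whose bit u x j equals u t j. Two distinct points isolated by the same
-- Boolean column carry both bit values, so every point is one of them; hence for q ≥ 3 the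
-- choice t ↦ j is injective and q ≤ n. Conversely, for q ≤ n a one-hot encoding u x = e_x
-- with ϑ_t = 0 in cell t and * elsewhere works, and for q = 2 a single cell comparing the
-- bit of x with the complement of the bit of t suffices.
{-# OPTIONS --safe #-}
module Submission where

open import Defs
open import Data.Bool using (Bool; true; false; not; if_then_else_)
open import Data.Bool.Properties using (∧-identityʳ; ¬-not) renaming (_≟_ to _≟ᵇ_)
open import Data.Empty using (⊥-elim)
open import Data.Fin using (Fin; _≟_; inject≤)
open import Data.Fin.Properties using (injective⇒≤; inject≤-injective)
open import Data.Nat using (ℕ; _≤_; _≥_; zero; suc)
open import Data.Nat.Properties using (_≤?_; ≤-antisym; ≤-trans; m≤n⇒m≤1+n)
open import Data.Product using (_×_; _,_; ∃; proj₁; proj₂)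
open import Data.Sum using (_⊎_; inj₁; inj₂)
open import Function.Bundles using (_⇔_; mk⇔)
open import Relation.Nullary using (yes; no)
open import Relation.Nullary.Decidable using (⌊_⌋)
open import Relation.Binary.PropositionalEquality
  using (_≡_; _≢_; refl; sym; trans; subst)

⋀-true : ∀ n (g : Fin n → Bool) → (∀ j → g j ≡ true) → ⋀ n g ≡ true
⋀-true zero    g all = refl
⋀-true (suc n) g all rewrite all Fin.zero =
  ⋀-true n (λ j → g (Fin.suc j)) (λ j → all (Fin.suc j))

⋀-single : ∀ n (g : Fin n → Bool) (i : Fin n) →
           (∀ j → j ≢ i → g j ≡ true) → ⋀ n g ≡ g i
⋀-single (suc n) g Fin.zero rest
  rewrite ⋀-true n (λ j → g (Fin.suc j)) (λ j → rest (Fin.suc j) λ ())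
  = ∧-identityʳ (g Fin.zero)
⋀-single (suc n) g (Fin.suc i) rest rewrite rest Fin.zero (λ ()) =
  ⋀-single n (λ j → g (Fin.suc j)) i (λ j j≢i → rest (Fin.suc j) λ { refl → j≢i refl })

⋀≡true⇒ : ∀ n (g : Fin n → Bool) → ⋀ n g ≡ true → ∀ j → g j ≡ true
⋀≡true⇒ (suc n) g ⋀≡true j with g Fin.zero in g₀≡
⋀≡true⇒ (suc n) g ⋀≡true Fin.zero    | true = g₀≡
⋀≡true⇒ (suc n) g ⋀≡true (Fin.suc j) | true = ⋀≡true⇒ n (λ k → g (Fin.suc k)) ⋀≡true j

⋀≡false⇒ : ∀ n (g : Fin n → Bool) → ⋀ n g ≡ false → ∃ λ j → g j ≡ false
⋀≡false⇒ (suc n) g ⋀≡false with g Fin.zero in g₀≡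
... | false = Fin.zero , g₀≡
... | true with ⋀≡false⇒ n (λ j → g (Fin.suc j)) ⋀≡false
...   | j , gj≡false = Fin.suc j , gj≡false

𝒩-diag : ∀ q (t : Fin q) → 𝒩 q t t ≡ false
𝒩-diag q t with t ≟ t
... | yes _  = refl
... | no t≢t = ⊥-elim (t≢t refl)

𝒩-off : ∀ q (t x : Fin q) → x ≢ t → 𝒩 q t x ≡ true
𝒩-off q t x x≢t with x ≟ t
... | yes x≡t = ⊥-elim (x≢t x≡t)
... | no _    = refl

module OneHot (q n : ℕ) (q≤n : q ≤ n) where

  cell : Fin q → Fin n
  cell x = inject≤ x q≤n

  u : Fin q → Fin n → Bool
  u x j = ⌊ j ≟ cell x ⌋

  ϑ : Fin q → Fin n → B*
  ϑ t j = if ⌊ j ≟ cell t ⌋ then bit false else star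

  test : Fin q → Fin q → Fin n → Bool
  test t x j = T (fromB∘ (u x j)) (fromB* (ϑ t j))

  test-off : ∀ t x j → j ≢ cell t → test t x j ≡ true
  test-off t x j j≢cell with j ≟ cell t
  ... | yes j≡cell = ⊥-elim (j≢cell j≡cell)
  ... | no _       = refl

  test-on : ∀ t x → test t x (cell t) ≡ 𝒩 q t x
  test-on t x with cell t ≟ cell t | x ≟ t
  ... | no c≢c | _ = ⊥-elim (c≢c refl)
  ... | yes _ | yes refl with cell x ≟ cell x
  ...   | yes _  = refl
  ...   | no c≢c = ⊥-elim (c≢c refl)
  test-on t x | yes _ | no x≢t with cell t ≟ cell x
  ...   | yes c≡c = ⊥-elim (x≢t (sym (inject≤-injective q≤n q≤n t x c≡c)))
  ...   | no _    = refl

  implementable : Implementable∘* q n (𝒩 q)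
  implementable = u , ϑ , λ t x →
    sym (trans (⋀-single n (test t x) (cell t) (test-off t x)) (test-on t x))

implementable-𝒩₂ : Implementable∘* 2 1 (𝒩 2)
implementable-𝒩₂ = (λ x _ → bitOf x) , (λ t _ → bit (not (bitOf t))) , implements
  where
  bitOf : Fin 2 → Bool
  bitOf Fin.zero    = false
  bitOf (Fin.suc _) = true

  implements : ∀ t x →
    𝒩 2 t x ≡ ⋀ 1 (λ _ → T (fromB∘ (bitOf x)) (fromB* (bit (not (bitOf t)))))
  implements Fin.zero             Fin.zero             = refl
  implements Fin.zero             (Fin.suc Fin.zero)   = refl
  implements (Fin.suc Fin.zero)   Fin.zero             = refl
  implements (Fin.suc Fin.zero)   (Fin.suc Fin.zero)   = refl

Isolates : ∀ {q} → (Fin q → Bool) → Fin q → Set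
Isolates c t = ∀ x → c x ≡ c t → x ≡ t

isolated-pair-covers : ∀ {q} {c : Fin q → Bool} {t t'} →
  Isolates c t → Isolates c t' → t ≢ t' → ∀ y → y ≡ t ⊎ y ≡ t'
isolated-pair-covers {c = c} {t} {t'} iso iso' t≢t' y with c y ≟ᵇ c t
... | yes cy≡ct = inj₁ (iso y cy≡ct)
... | no cy≢ct  = inj₂ (iso' y (trans (¬-not cy≢ct) (sym (¬-not ct'≢ct))))
  where
  ct'≢ct : c t' ≢ c t
  ct'≢ct ct'≡ct = t≢t' (sym (iso t' ct'≡ct))

covered-by-two⇒≤2 : ∀ {q} (t t' : Fin q) → (∀ y → y ≡ t ⊎ y ≡ t') → q ≤ 2
covered-by-two⇒≤2 {q} t t' covers = injective⇒≤ {f = outside-t} outside-t-injective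
  where
  outside-t : Fin q → Fin 2
  outside-t y = if ⌊ y ≟ t ⌋ then Fin.zero else Fin.suc Fin.zero

  on-t' : ∀ {y} → y ≢ t → y ≡ t'
  on-t' {y} y≢t with covers y
  ... | inj₁ y≡t  = ⊥-elim (y≢t y≡t)
  ... | inj₂ y≡t' = y≡t'

  outside-t-injective : ∀ {y y'} → outside-t y ≡ outside-t y' → y ≡ y'
  outside-t-injective {y} {y'} eq with y ≟ t | y' ≟ t
  ... | yes y≡t | yes y'≡t = trans y≡t (sym y'≡t)
  ... | no y≢t  | no y'≢t  = trans (on-t' y≢t) (sym (on-t' y'≢t))
  outside-t-injective () | yes _ | no _
  outside-t-injective () | no _  | yes _

module Necessity {q n : ℕ} (u : Fin q → Fin n → Bool) (ϑ : Fin q → Fin n → B*)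
  (implements : ∀ t x → 𝒩 q t x ≡ ⋀ n (λ j → T (fromB∘ (u x j)) (fromB* (ϑ t j))))
  where

  isolating-cell : ∀ t → ∃ λ j → Isolates (λ x → u x j) t
  isolating-cell t = j , isolated
    where
    rejects-t : ∃ λ j → T (fromB∘ (u t j)) (fromB* (ϑ t j)) ≡ false
    rejects-t = ⋀≡false⇒ n _ (trans (sym (implements t t)) (𝒩-diag q t))

    j : Fin n
    j = proj₁ rejects-t

    isolated : Isolates (λ x → u x j) t
    isolated x ux≡ut with x ≟ t
    ... | yes x≡t = x≡t
    ... | no x≢t
      with ⋀≡true⇒ n _ (trans (sym (implements t x)) (𝒩-off q t x x≢t)) j
    ...   | accepts-x rewrite ux≡ut with trans (sym accepts-x) (proj₂ rejects-t)
    ...     | ()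

  ≤2⊎≤n : q ≤ 2 ⊎ q ≤ n
  ≤2⊎≤n with q ≤? 2
  ... | yes q≤2 = inj₁ q≤2
  ... | no q≰2  = inj₂ (injective⇒≤ {f = cell} cell-injective)
    where
    cell : Fin q → Fin n
    cell t = proj₁ (isolating-cell t)

    cell-injective : ∀ {t t'} → cell t ≡ cell t' → t ≡ t'
    cell-injective {t} {t'} eq with t ≟ t'
    ... | yes t≡t' = t≡t'
    ... | no t≢t'  = ⊥-elim (q≰2 (covered-by-two⇒≤2 t t'
          (isolated-pair-covers (proj₂ (isolating-cell t))
             (subst (λ j → Isolates (λ x → u x j) t') (sym eq) (proj₂ (isolating-cell t')))
             t≢t')))

implementable⇒≤2⊎≤n : ∀ {q n} → Implementable∘* q n (𝒩 q) → q ≤ 2 ⊎ q ≤ n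
implementable⇒≤2⊎≤n (u , ϑ , implements) = Necessity.≤2⊎≤n u ϑ implements

proposition6 : (q n : ℕ) → q ≥ 2 → n ≥ 1 →
    ((n ≡ 1 → (Implementable∘* q n (𝒩 q) ⇔ q ≤ 2)) ×
     (n ≥ 2 → (Implementable∘* q n (𝒩 q) ⇔ q ≤ n)))
proposition6 q n q≥2 n≥1 = one-cell , many-cells
  where
  one-cell : n ≡ 1 → (Implementable∘* q n (𝒩 q) ⇔ q ≤ 2)
  one-cell refl = mk⇔ necessary sufficient
    where
    necessary : Implementable∘* q 1 (𝒩 q) → q ≤ 2
    necessary impl with implementable⇒≤2⊎≤n impl
    ... | inj₁ q≤2 = q≤2
    ... | inj₂ q≤1 = m≤n⇒m≤1+n q≤1

    sufficient : q ≤ 2 → Implementable∘* q 1 (𝒩 q)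
    sufficient q≤2 with ≤-antisym q≤2 q≥2
    ... | refl = implementable-𝒩₂

  many-cells : n ≥ 2 → (Implementable∘* q n (𝒩 q) ⇔ q ≤ n)
  many-cells n≥2 = mk⇔ necessary (λ q≤n → OneHot.implementable q n q≤n)
    where
    necessary : Implementable∘* q n (𝒩 q) → q ≤ n
    necessary impl with implementable⇒≤2⊎≤n impl
    ... | inj₁ q≤2 = ≤-trans q≤2 n≥2
    ... | inj₂ q≤n = q≤n
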